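{- Let $S$ be an LA-semigroup and $\gamma,\delta\in[0,1]$ with $\gamma<\delta$. A fuzzy subset $\mu$ of $S$ is an $(\in_\gamma,\in_\gamma\vee q_\delta)$-fuzzy generalized bi-ideal of $S$ if and only if $\mu((as)b)\vee\gamma\geq\mu(a)\wedge\mu(b)\wedge\delta$ for all $a,b,s\in S$.
   Context: An LA-semigroup is a non-empty set $S$ with a binary operation (juxtaposition) satisfying $(xy)z=(zy)x$ for all $x,y,z\in S$. A fuzzy subset is a map $\mu:S\to[0,1]$; $\vee,\wedge$ denote max, min. For $x\in S$, $t\in(0,1]$, $x_t$ is the fuzzy point with support $x$ and value $t$. $x_t\in_\gamma\mu$ means $\mu(x)\geq t>\gamma$; $x_t q_\delta\mu$ means $\mu(x)+t>2\delta$; $x_t\in_\gamma\vee q_\delta\mu$ means $x_t\in_\gamma\mu$ or $x_t q_\delta\mu$. $\mu$ is an $(\in_\gamma,\in_\gamma\vee q_\delta)$-fuzzy generalized bi-ideal of $S$ if for all $a,b,s\in S$ and $t,r\in(\gamma,1]$, $a_t\in_\gamma\mu$ and $b_r\in_\gamma\mu$ imply $((as)b)_{t\wedge r}\in_\gamma\vee q_\delta\mu$. -}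

module Defs where

open import Level using (Level; zero; suc)
open import Data.Product using (Σ; _×_; _,_; ∃)
open import Data.Sum using (_⊎_; inj₁; inj₂)
open import Relation.Binary.PropositionalEquality using (_≡_)
open import Relation.Nullary using (¬_)

-- The real numbers, axiomatised (classically) as a complete ordered
-- field.  Any model is isomorphic to ℝ, so quantifying over all models
-- is the same as speaking about ℝ.

record RealField : Set₁ where
  infixl 6 _+_
  infixl 7 _*_
  infix  4 _<_
  field
    ℝ   : Set
    0ℝ 1ℝ : ℝ
    _+_ _*_ : ℝ → ℝ → ℝ
    -_  : ℝ → ℝ
    _<_ : ℝ → ℝ → Set
    +-assoc  : ∀ x y z → (x + y) + z ≡ x + (y + z)
    +-comm   : ∀ x y → x + y ≡ y + x
    +-idʳ    : ∀ x → x + 0ℝ ≡ x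
    +-invʳ   : ∀ x → x + (- x) ≡ 0ℝ
    *-assoc  : ∀ x y z → (x * y) * z ≡ x * (y * z)
    *-comm   : ∀ x y → x * y ≡ y * x
    *-idʳ    : ∀ x → x * 1ℝ ≡ x
    *-inv    : ∀ x → ¬ (x ≡ 0ℝ) → Σ ℝ (λ y → x * y ≡ 1ℝ)
    distribˡ : ∀ x y z → x * (y + z) ≡ x * y + x * z
    0≢1      : ¬ (0ℝ ≡ 1ℝ)
    <-irrefl : ∀ x → ¬ (x < x)
    <-trans  : ∀ {x y z} → x < y → y < z → x < z
    <-tri    : ∀ x y → (x < y) ⊎ ((x ≡ y) ⊎ (y < x))
    +-mono-< : ∀ {x y} z → x < y → x + z < y + z
    *-pos    : ∀ {x y} → 0ℝ < x → 0ℝ < y → 0ℝ < x * y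
  _≤_ : ℝ → ℝ → Set
  x ≤ y = (x < y) ⊎ (x ≡ y)
  field
    complete : ∀ (P : ℝ → Set) → Σ ℝ P → Σ ℝ (λ u → ∀ x → P x → x ≤ u) →
               Σ ℝ (λ s → (∀ x → P x → x ≤ s) ×
                          (∀ u → (∀ x → P x → x ≤ u) → s ≤ u))

  infix 4 _≤_
  infixl 6 _∨_
  infixl 7 _∧_

  _∨_ : ℝ → ℝ → ℝ
  x ∨ y with <-tri x y
  ... | inj₁ _ = y
  ... | inj₂ _ = x

  _∧_ : ℝ → ℝ → ℝ
  x ∧ y with <-tri x y
  ... | inj₁ _ = x
  ... | inj₂ _ = y

  InUnit : ℝ → Set
  InUnit x = (0ℝ ≤ x) × (x ≤ 1ℝ)

record LASemigroup : Set₁ where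
  infixl 7 _·_
  field
    Carrier : Set
    _·_     : Carrier → Carrier → Carrier
    left-invertive : ∀ x y z → (x · y) · z ≡ (z · y) · x

module Fuzzy (R : RealField) (S : LASemigroup) where
  open RealField R
  open LASemigroup S

  IsFuzzySubset : (Carrier → ℝ) → Set
  IsFuzzySubset μ = ∀ x → InUnit (μ x)

  ∈[_] : ℝ → (Carrier → ℝ) → Carrier → ℝ → Set
  ∈[ γ ] μ x t = (t ≤ μ x) × (γ < t)

  q[_] : ℝ → (Carrier → ℝ) → Carrier → ℝ → Set
  q[ δ ] μ x t = δ + δ < μ x + t

  ∈∨q[_,_] : ℝ → ℝ → (Carrier → ℝ) → Carrier → ℝ → Set
  ∈∨q[ γ , δ ] μ x t = ∈[ γ ] μ x t ⊎ q[ δ ] μ x t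

  IsFuzzyGenBiIdeal : ℝ → ℝ → (Carrier → ℝ) → Set
  IsFuzzyGenBiIdeal γ δ μ =
    ∀ (a b s : Carrier) (t r : ℝ) →
      γ < t → t ≤ 1ℝ → γ < r → r ≤ 1ℝ →
      ∈[ γ ] μ a t → ∈[ γ ] μ b r →
      ∈∨q[ γ , δ ] μ ((a · s) · b) (t ∧ r)

-- For a threshold t with γ < t ≤ δ, the fuzzy point x_t lies ∈_γ ∨ q_δ in μ
-- exactly when t ≤ μ x ∨ γ: being quasi-coincident at level δ while t ≤ δ
-- already forces δ < μ x.  Testing the bi-ideal condition at the single level
-- t = r = μ a ∧ μ b ∧ δ gives the inequality.  Conversely the inequality,
-- applied to t ∧ r ≤ μ a ∧ μ b, yields membership when t ∧ r ≤ δ, and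
-- δ ≤ μ((as)b), hence quasi-coincidence, when t ∧ r > δ.
module Submission where

open import Defs
open import Function.Bundles using (_⇔_; mk⇔)
open import Data.Product using (_,_)
open import Data.Sum using (_⊎_; inj₁; inj₂)
open import Data.Empty using (⊥; ⊥-elim)
open import Relation.Binary.PropositionalEquality using (_≡_; refl; sym; subst; subst₂)

module OrderedFieldProperties (R : RealField) where
  open RealField R

  ≤-refl : ∀ {x} → x ≤ x
  ≤-refl = inj₂ refl

  ≤-trans : ∀ {x y z} → x ≤ y → y ≤ z → x ≤ z
  ≤-trans (inj₁ x<y) (inj₁ y<z) = inj₁ (<-trans x<y y<z)
  ≤-trans (inj₁ x<y) (inj₂ refl) = inj₁ x<y
  ≤-trans (inj₂ refl) y≤z = y≤z

  <-≤-trans : ∀ {x y z} → x < y → y ≤ z → x < z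
  <-≤-trans x<y (inj₁ y<z) = <-trans x<y y<z
  <-≤-trans x<y (inj₂ refl) = x<y

  ≤-<-trans : ∀ {x y z} → x ≤ y → y < z → x < z
  ≤-<-trans (inj₁ x<y) y<z = <-trans x<y y<z
  ≤-<-trans (inj₂ refl) y<z = y<z

  <⇒≱ : ∀ {x y} → x < y → y ≤ x → ⊥
  <⇒≱ x<y (inj₁ y<x) = <-irrefl _ (<-trans x<y y<x)
  <⇒≱ x<y (inj₂ refl) = <-irrefl _ x<y

  ≤⊎> : ∀ x y → x ≤ y ⊎ y < x
  ≤⊎> x y with <-tri x y
  ... | inj₁ x<y = inj₁ (inj₁ x<y)
  ... | inj₂ (inj₁ x≡y) = inj₁ (inj₂ x≡y)
  ... | inj₂ (inj₂ y<x) = inj₂ y<x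

  +-monoˡ-≤ : ∀ {x y} z → x ≤ y → x + z ≤ y + z
  +-monoˡ-≤ z (inj₁ x<y) = inj₁ (+-mono-< z x<y)
  +-monoˡ-≤ z (inj₂ refl) = ≤-refl

  +-monoʳ-≤ : ∀ {x y} z → x ≤ y → z + x ≤ z + y
  +-monoʳ-≤ {x} {y} z x≤y =
    subst₂ _≤_ (+-comm x z) (+-comm y z) (+-monoˡ-≤ z x≤y)

  +-monoʳ-< : ∀ {x y} z → x < y → z + x < z + y
  +-monoʳ-< {x} {y} z x<y =
    subst₂ _<_ (+-comm x z) (+-comm y z) (+-mono-< z x<y)

  +-mono-≤ : ∀ {x y u v} → x ≤ y → u ≤ v → x + u ≤ y + v
  +-mono-≤ {y = y} {u} x≤y u≤v = ≤-trans (+-monoˡ-≤ u x≤y) (+-monoʳ-≤ y u≤v)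

  +-mono-≤-< : ∀ {x y u v} → x ≤ y → u < v → x + u < y + v
  +-mono-≤-< {x} {v = v} x≤y u<v = <-≤-trans (+-monoʳ-< x u<v) (+-monoˡ-≤ v x≤y)

  ∧-sel : ∀ x y → (x ∧ y ≡ x) ⊎ (x ∧ y ≡ y)
  ∧-sel x y with <-tri x y
  ... | inj₁ _ = inj₁ refl
  ... | inj₂ _ = inj₂ refl

  ∨-sel : ∀ x y → (x ∨ y ≡ x) ⊎ (x ∨ y ≡ y)
  ∨-sel x y with <-tri x y
  ... | inj₁ _ = inj₂ refl
  ... | inj₂ _ = inj₁ refl

  ∧-idem : ∀ x → x ∧ x ≡ x
  ∧-idem x with ∧-sel x x
  ... | inj₁ e = e
  ... | inj₂ e = e

  x∧y≤x : ∀ x y → x ∧ y ≤ x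
  x∧y≤x x y with <-tri x y
  ... | inj₁ _ = ≤-refl
  ... | inj₂ (inj₁ x≡y) = inj₂ (sym x≡y)
  ... | inj₂ (inj₂ y<x) = inj₁ y<x

  x∧y≤y : ∀ x y → x ∧ y ≤ y
  x∧y≤y x y with <-tri x y
  ... | inj₁ x<y = inj₁ x<y
  ... | inj₂ _ = ≤-refl

  x≤x∨y : ∀ x y → x ≤ x ∨ y
  x≤x∨y x y with <-tri x y
  ... | inj₁ x<y = inj₁ x<y
  ... | inj₂ _ = ≤-refl

  y≤x∨y : ∀ x y → y ≤ x ∨ y
  y≤x∨y x y with <-tri x y
  ... | inj₁ _ = ≤-refl
  ... | inj₂ (inj₁ x≡y) = inj₂ (sym x≡y)
  ... | inj₂ (inj₂ y<x) = inj₁ y<x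

  ∧-greatest : ∀ {x y z} → z ≤ x → z ≤ y → z ≤ x ∧ y
  ∧-greatest {x} {y} {z} z≤x z≤y with ∧-sel x y
  ... | inj₁ e = subst (z ≤_) (sym e) z≤x
  ... | inj₂ e = subst (z ≤_) (sym e) z≤y

  ∧-greatest-< : ∀ {x y z} → z < x → z < y → z < x ∧ y
  ∧-greatest-< {x} {y} {z} z<x z<y with ∧-sel x y
  ... | inj₁ e = subst (z <_) (sym e) z<x
  ... | inj₂ e = subst (z <_) (sym e) z<y

  ∧-monoˡ-≤ : ∀ {x y} z → x ≤ y → x ∧ z ≤ y ∧ z
  ∧-monoˡ-≤ {x} z x≤y = ∧-greatest (≤-trans (x∧y≤x x z) x≤y) (x∧y≤y x z)

  ≤∨-cancelʳ : ∀ {x y z} → z < x → x ≤ y ∨ z → x ≤ y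
  ≤∨-cancelʳ {x} {y} {z} z<x x≤y∨z with ∨-sel y z
  ... | inj₁ e = subst (x ≤_) e x≤y∨z
  ... | inj₂ e = ⊥-elim (<⇒≱ z<x (subst (x ≤_) e x≤y∨z))

module FuzzyPointProperties (R : RealField) (S : LASemigroup)
                            (μ : LASemigroup.Carrier S → RealField.ℝ R) where
  open RealField R
  open LASemigroup S
  open Fuzzy R S
  open OrderedFieldProperties R

  q-below-level⇒> : ∀ {δ t} x → t ≤ δ → q[ δ ] μ x t → δ < μ x
  q-below-level⇒> {δ} {t} x t≤δ δ+δ<μx+t with ≤⊎> (μ x) δ
  ... | inj₁ μx≤δ = ⊥-elim (<⇒≱ δ+δ<μx+t (+-mono-≤ μx≤δ t≤δ))
  ... | inj₂ δ<μx = δ<μx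

  ∈∨q⇒≤∨ : ∀ {γ δ t} x → t ≤ δ → ∈∨q[ γ , δ ] μ x t → t ≤ μ x ∨ γ
  ∈∨q⇒≤∨ {γ} x _ (inj₁ (t≤μx , _)) = ≤-trans t≤μx (x≤x∨y (μ x) γ)
  ∈∨q⇒≤∨ {γ} x t≤δ (inj₂ q) =
    ≤-trans (inj₁ (≤-<-trans t≤δ (q-below-level⇒> x t≤δ q))) (x≤x∨y (μ x) γ)

  ∧-level-≤⇒∈∨q : ∀ {γ δ t} x → γ < t → t ∧ δ ≤ μ x → ∈∨q[ γ , δ ] μ x t
  ∧-level-≤⇒∈∨q {δ = δ} {t} x γ<t t∧δ≤μx with ≤⊎> t δ
  ... | inj₁ t≤δ = inj₁ (≤-trans (∧-greatest ≤-refl t≤δ) t∧δ≤μx , γ<t)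
  ... | inj₂ δ<t = inj₂ (+-mono-≤-< (≤-trans (∧-greatest (inj₁ δ<t) ≤-refl) t∧δ≤μx) δ<t)

  ≤∨⇒∈∨q : ∀ {γ δ t} x → γ < δ → γ < t → t ∧ δ ≤ μ x ∨ γ → ∈∨q[ γ , δ ] μ x t
  ≤∨⇒∈∨q x γ<δ γ<t t∧δ≤μx∨γ =
    ∧-level-≤⇒∈∨q x γ<t (≤∨-cancelʳ (∧-greatest-< γ<t γ<δ) t∧δ≤μx∨γ)

mainTheorem10 : (R : RealField) (S : LASemigroup) →
    let open RealField R
        open LASemigroup S
        open Fuzzy R S
    in (γ δ : ℝ) → InUnit γ → InUnit δ → γ < δ →
       (μ : Carrier → ℝ) → IsFuzzySubset μ →
       IsFuzzyGenBiIdeal γ δ μ ⇔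
         (∀ (a b s : Carrier) → (μ a ∧ μ b) ∧ δ ≤ μ ((a · s) · b) ∨ γ)
mainTheorem10 R S γ δ _ (_ , δ≤1) γ<δ μ _ = mk⇔ toInequality fromInequality
  where
  open RealField R
  open LASemigroup S
  open Fuzzy R S
  open OrderedFieldProperties R
  open FuzzyPointProperties R S μ

  toInequality : IsFuzzyGenBiIdeal γ δ μ →
                 ∀ a b s → (μ a ∧ μ b) ∧ δ ≤ μ ((a · s) · b) ∨ γ
  toInequality isBiIdeal a b s with ≤⊎> ((μ a ∧ μ b) ∧ δ) γ
  ... | inj₁ m≤γ = ≤-trans m≤γ (y≤x∨y _ γ)
  ... | inj₂ γ<m = ∈∨q⇒≤∨ ((a · s) · b) m≤δ (subst (∈∨q[ γ , δ ] μ ((a · s) · b)) (∧-idem m) atLevelm)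
    where
    m : ℝ
    m = (μ a ∧ μ b) ∧ δ
    m≤μa∧μb : m ≤ μ a ∧ μ b
    m≤μa∧μb = x∧y≤x (μ a ∧ μ b) δ
    m≤δ : m ≤ δ
    m≤δ = x∧y≤y (μ a ∧ μ b) δ
    m≤1 : m ≤ 1ℝ
    m≤1 = ≤-trans m≤δ δ≤1
    atLevelm : ∈∨q[ γ , δ ] μ ((a · s) · b) (m ∧ m)
    atLevelm = isBiIdeal a b s m m γ<m m≤1 γ<m m≤1
                 (≤-trans m≤μa∧μb (x∧y≤x (μ a) (μ b)) , γ<m)
                 (≤-trans m≤μa∧μb (x∧y≤y (μ a) (μ b)) , γ<m)

  fromInequality : (∀ a b s → (μ a ∧ μ b) ∧ δ ≤ μ ((a · s) · b) ∨ γ) →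
                   IsFuzzyGenBiIdeal γ δ μ
  fromInequality ineq a b s t r γ<t _ γ<r _ (t≤μa , _) (r≤μb , _) =
    ≤∨⇒∈∨q ((a · s) · b) γ<δ (∧-greatest-< γ<t γ<r)
      (≤-trans (∧-monoˡ-≤ δ t∧r≤μa∧μb) (ineq a b s))
    where
    t∧r≤μa∧μb : t ∧ r ≤ μ a ∧ μ b
    t∧r≤μa∧μb = ∧-greatest (≤-trans (x∧y≤x t r) t≤μa) (≤-trans (x∧y≤y t r) r≤μb)
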